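{- For every $n\ge 1$, the Wiener indices of the spiro ortho-chain $O_n$, the spiro meta-chain $M_n$ and the spiro para-chain $P_n$ are $$W(O_n)=\frac{25}{6}n^3+\frac{65}{2}n^2-\frac{29}{3}n,\quad W(M_n)=\frac{25}{3}n^3+20n^2-\frac43 n,\quad W(P_n)=\frac{25}{2}n^3+\frac{15}{2}n^2+7n.$$
   Context: The Wiener index is $W(G)=\sum_{\{u,v\}\subseteq V(G)} d(u,v)$, with $d$ the shortest-path distance. A spiro hexagonal chain with $n$ hexagons is a graph $G_n=H_0H_1\cdots H_{n-1}$ that is the union of hexagons (6-cycles) $H_0,\dots,H_{n-1}$ such that for $1\le k\le n-1$, $H_{k-1}$ and $H_k$ share exactly one vertex $c_k$, the $c_k$ are distinct, and $H_i,H_j$ are disjoint when $|i-j|\ge 2$. The spiro ortho-chain $O_n$ (resp. meta-chain $M_n$, para-chain $P_n$) is the spiro hexagonal chain in which $d(c_{k-1},c_k)=1$ (resp. $2$, resp. $3$) for all $2\le k\le n-1$. -}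

module Defs where

open import Data.Nat using (ℕ; zero; suc; _+_; _*_; _∸_; _≡ᵇ_; _<ᵇ_)
open import Data.Bool using (Bool; true; false; _∧_; _∨_; if_then_else_)
open import Data.List using (List; []; _∷_; _++_; map; concatMap; length; upTo)
open import Data.Bool.ListAction using (any)
open import Data.Nat.ListAction using (sum)
open import Data.Product using (_×_; _,_)

-- A spiro hexagonal chain with n hexagons H_0 … H_{n-1} is encoded by an
-- "offset" function  off : ℕ → ℕ.  Vertices are the naturals 0 … 5n.
--   * c 0 = 0 (an auxiliary base vertex of H_0),
--   * hexagon H_k is the 6-cycle
--        c k — 5k+1 — 5k+2 — 5k+3 — 5k+4 — 5k+5 — c k ,
--     i.e. the vertex at cyclic position j (1 ≤ j ≤ 5) of H_k is 5k+j,
--   * the cut vertex shared by H_k and H_{k+1} is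
--        c (k+1) = 5k + off k   (the vertex at cyclic position off k of H_k).
-- With 1 ≤ off k ≤ 5 for k < n-1 this gives exactly the spiro hexagonal
-- chains (every one is isomorphic to such an encoding).

c : (ℕ → ℕ) → ℕ → ℕ
c off zero    = 0
c off (suc k) = 5 * k + off k

hexEdges : (ℕ → ℕ) → ℕ → List (ℕ × ℕ)
hexEdges off k =
  (c off k , 5 * k + 1) ∷ (5 * k + 1 , 5 * k + 2) ∷ (5 * k + 2 , 5 * k + 3) ∷
  (5 * k + 3 , 5 * k + 4) ∷ (5 * k + 4 , 5 * k + 5) ∷ (5 * k + 5 , c off k) ∷ []

edges : ℕ → (ℕ → ℕ) → List (ℕ × ℕ)
edges n off = concatMap (hexEdges off) (upTo n)

vertices : ℕ → List ℕ
vertices n = upTo (suc (5 * n))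

adj : ℕ → (ℕ → ℕ) → ℕ → ℕ → Bool
adj n off u v = any (λ e → isEdge e) (edges n off)
  where
  isEdge : ℕ × ℕ → Bool
  isEdge (a , b) = ((a ≡ᵇ u) ∧ (b ≡ᵇ v)) ∨ ((a ≡ᵇ v) ∧ (b ≡ᵇ u))

reach : ℕ → (ℕ → ℕ) → ℕ → ℕ → ℕ → Bool
reach n off zero    u v = u ≡ᵇ v
reach n off (suc k) u v =
  reach n off k u v ∨ any (λ w → adj n off u w ∧ reach n off k w v) (vertices n)

searchDist : ℕ → (ℕ → ℕ) → ℕ → ℕ → ℕ → ℕ → ℕ
searchDist n off u v k zero       = k
searchDist n off u v k (suc fuel) =
  if reach n off k u v then k else searchDist n off u v (suc k) fuel

-- shortest-path distance d(u,v) in G_n (G_n is connected with 5n+1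
-- vertices, so the search up to 5n+1 always finds the true distance).
dist : ℕ → (ℕ → ℕ) → ℕ → ℕ → ℕ
dist n off u v = searchDist n off u v 0 (length (vertices n))

wiener : ℕ → (ℕ → ℕ) → ℕ
wiener n off =
  sum (concatMap (λ u → map (λ v → if u <ᵇ v then dist n off u v else 0)
                            (vertices n))
                 (vertices n))

IsSpiroChain : ℕ → (ℕ → ℕ) → Set
IsSpiroChain n off = ∀ k → suc k < n → 1 ≤ off k × off k ≤ 5
  where open import Data.Nat using (_<_; _≤_)

-- In a spiro chain a geodesic climbs through the hexagons between two
-- vertices from cut vertex to cut vertex, so distances obey an explicit
-- formula spiroDist (hexagon distances at both ends plus the distances
-- between consecutive cut vertices).  We first show that spiroDist is the
-- graph distance dist of Defs: it changes by at most one along an edge, and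
-- every vertex other than the target has a neighbour one step closer, so
-- the bounded walk search in dist stops exactly at spiroDist.  Facts about a
-- single hexagon are checked by evaluation on all pairs of positions.  Then
-- the Wiener index is built up one hexagon at a time: the five new vertices
-- contribute 18 among themselves and 5·d(u, c N) + 9 with each old vertex u,
-- and the distance sum to the newest cut vertex satisfies a similar
-- recurrence.  If all inner cut vertices are at distance t this yields
-- 6·W(G_n) = 25t·n(n-1)(n-2) + 270·n(n-1) + 162·n (wiener-uniform), and
-- t = 1, 2, 3 give the three formulas of the corollary.
module Submission where

open import Defs
open import Data.Nat using (ℕ; zero; suc; pred; _+_; _*_; _^_; _∸_; _⊓_; _⊔_; ∣_-_∣; _/_; _%_;
  _≤_; _<_; _≡ᵇ_; _<ᵇ_; _≤ᵇ_; z≤n; s≤s; s≤s⁻¹; z<s; s<s)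
open import Data.Nat.Properties
open import Data.Nat.DivMod using (m≡m%n+[m/n]*n; m%n<n; +-distrib-/; m*n/n≡m; m*n%n≡0;
  m<n⇒m/n≡0; m<n⇒m%n≡m; [m+kn]%n≡m%n; m<n*o⇒m/o<n)
open import Data.Nat.Tactic.RingSolver using (solve-∀)
open import Data.Nat.ListAction using (sum)
open import Data.Nat.ListAction.Properties using (sum-++)
open import Data.Bool using (Bool; true; false; T; not; _∧_; _∨_; if_then_else_)
open import Data.Bool.Properties using (T-∨; T-∧; T-≡)
open import Data.Bool.ListAction using (all)
open import Data.Product using (_×_; _,_; proj₁; proj₂; ∃-syntax)
open import Data.Sum using (_⊎_; inj₁; inj₂; [_,_]′)
open import Data.Empty using (⊥-elim)
open import Data.List using (List; []; _∷_; _++_; map; concatMap; length; upTo; applyUpTo; _∷ʳ_)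
open import Data.List.Properties using (length-upTo; upTo-∷ʳ; applyUpTo-∷ʳ; ++-assoc; ++-identityʳ;
  map-cong; map-upTo; map-++; map-∘)
open import Data.List.Membership.Propositional using (_∈_; find; lose)
open import Data.List.Membership.Propositional.Properties using (∈-upTo⁺; ∈-upTo⁻)
open import Data.List.Relation.Unary.Any using (here; there)
open import Data.List.Relation.Unary.Any.Properties using (any⁺; any⁻; concatMap⁺; concatMap⁻)
open import Data.List.Relation.Unary.All using (lookup)
open import Data.List.Relation.Unary.All.Properties using (all⁺)
open import Function using (_∘_; Equivalence)
open import Relation.Nullary using (yes; no)
open import Relation.Binary.PropositionalEquality
open import Relation.Binary.Definitions using (tri<; tri≈; tri>)

open Equivalence using (to; from)
open import Algebra.Properties.CommutativeSemigroup +-commutativeSemigroup using (interchange)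

-- Positions are 0,…,5 around the hexagon; larger numbers are clamped to 5
-- so that every hexagon function is total and needs no side conditions.
clamp : ℕ → ℕ
clamp p = p ⊓ 5

clamp≤5 : ∀ p → clamp p ≤ 5
clamp≤5 p = m⊓n≤n p 5

clamp-id : ∀ {p} → p ≤ 5 → clamp p ≡ p
clamp-id = m≤n⇒m⊓n≡m

clamp-idem : ∀ p → clamp (clamp p) ≡ clamp p
clamp-idem p = clamp-id (clamp≤5 p)

next prev : ℕ → ℕ
next p = suc (clamp p) % 6
prev p = (clamp p + 5) % 6

next≤5 : ∀ p → next p ≤ 5
next≤5 p = s≤s⁻¹ (m%n<n (suc (clamp p)) 6)

prev≤5 : ∀ p → prev p ≤ 5
prev≤5 p = s≤s⁻¹ (m%n<n (clamp p + 5) 6)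

prev-next : ∀ i → i ≤ 5 → prev (next i) ≡ i
prev-next 0 _ = refl
prev-next 1 _ = refl
prev-next 2 _ = refl
prev-next 3 _ = refl
prev-next 4 _ = refl
prev-next 5 _ = refl
prev-next (suc (suc (suc (suc (suc (suc _)))))) (s≤s (s≤s (s≤s (s≤s (s≤s ())))))

next-prev : ∀ i → i ≤ 5 → next (prev i) ≡ i
next-prev 0 _ = refl
next-prev 1 _ = refl
next-prev 2 _ = refl
next-prev 3 _ = refl
next-prev 4 _ = refl
next-prev 5 _ = refl
next-prev (suc (suc (suc (suc (suc (suc _)))))) (s≤s (s≤s (s≤s (s≤s (s≤s ())))))

cycDist : ℕ → ℕ → ℕ
cycDist a b = ∣ a - b ∣ ⊓ (6 ∸ ∣ a - b ∣)

hexDist : ℕ → ℕ → ℕ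
hexDist p q = cycDist (clamp p) (clamp q)

hexDist-sym : ∀ p q → hexDist p q ≡ hexDist q p
hexDist-sym p q rewrite ∣-∣-comm (clamp p) (clamp q) = refl

hexDist-self : ∀ p → hexDist p p ≡ 0
hexDist-self p rewrite ∣n-n∣≡0 (clamp p) = refl

hexDist-clampʳ : ∀ p q → hexDist p (clamp q) ≡ hexDist p q
hexDist-clampʳ p q = cong (cycDist (clamp p)) (clamp-idem q)

View : Set
View = ℕ × ℕ × ℕ × ℕ × ℕ

viewAt : ℕ → ℕ → View
viewAt a b = a , b , cycDist a b , cycDist (clamp (suc a % 6)) b , cycDist (clamp ((a + 5) % 6)) b

view : ℕ → ℕ → View
view p q = viewAt (clamp p) (clamp q)

positions : List ℕ
positions = upTo 6

byEvaluation : (P : View → Bool) → T (all (λ a → all (λ b → P (view a b)) positions) positions) →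
               ∀ p q → T (P (view p q))
byEvaluation P ok p q = subst (T ∘ P) (cong₂ viewAt (clamp-idem p) (clamp-idem q)) atClamped
  where
  clamp∈ : ∀ p → clamp p ∈ positions
  clamp∈ p = ∈-upTo⁺ (s≤s (clamp≤5 p))
  row : T (all (λ b → P (view (clamp p) b)) positions)
  row = lookup (all⁺ (λ a → all (λ b → P (view a b)) positions) positions ok) (clamp∈ p)
  atClamped : T (P (view (clamp p) (clamp q)))
  atClamped = lookup (all⁺ (λ b → P (view (clamp p) b)) positions row) (clamp∈ q)

hexDist≤3 : ∀ p q → hexDist p q ≤ 3
hexDist≤3 p q = ≤ᵇ⇒≤ _ 3 (byEvaluation (λ (_ , _ , d , _) → d ≤ᵇ 3) _ p q)

hexDist-next : ∀ p q → hexDist p q ≤ suc (hexDist (next p) q)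
hexDist-next p q = ≤ᵇ⇒≤ _ _ (byEvaluation (λ (_ , _ , d , dn , _) → d ≤ᵇ suc dn) _ p q)

hexDist-prev : ∀ p q → hexDist p q ≤ suc (hexDist (prev p) q)
hexDist-prev p q = ≤ᵇ⇒≤ _ _ (byEvaluation (λ (_ , _ , d , _ , dp) → d ≤ᵇ suc dp) _ p q)

hexDist-descent : ∀ p q r → hexDist p q ≡ suc r → hexDist (next p) q ≡ r ⊎ hexDist (prev p) q ≡ r
hexDist-descent p q r e with to T-∨ (byEvaluation
  (λ (_ , _ , d , dn , dp) → (d ≡ᵇ 0) ∨ (suc dn ≡ᵇ d) ∨ (suc dp ≡ᵇ d)) _ p q)
... | inj₁ d≡0 = ⊥-elim (0≢1+n (trans (sym (≡ᵇ⇒≡ _ 0 d≡0)) e))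
... | inj₂ closer with to T-∨ closer
...   | inj₁ dn = inj₁ (suc-injective (trans (≡ᵇ⇒≡ _ _ dn) e))
...   | inj₂ dp = inj₂ (suc-injective (trans (≡ᵇ⇒≡ _ _ dp) e))

hexDist≡0 : ∀ {p q} → p ≤ 5 → q ≤ 5 → hexDist p q ≡ 0 → p ≡ q
hexDist≡0 {p} {q} p≤5 q≤5 e with to T-∨ (byEvaluation (λ (a , b , d , _) → not (d ≡ᵇ 0) ∨ (a ≡ᵇ b)) _ p q)
... | inj₁ d≢0 = ⊥-elim (subst (λ d → T (not (d ≡ᵇ 0))) e d≢0)
... | inj₂ a≡b = trans (sym (clamp-id p≤5)) (trans (≡ᵇ⇒≡ _ _ a≡b) (clamp-id q≤5))

hexDist-total : ∀ q → sum (map (λ j → hexDist j q) positions) ≡ 9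
hexDist-total q = trans (cong sum (map-cong (λ j → sym (hexDist-clampʳ j q)) positions))
  (≡ᵇ⇒≡ _ 9 (byEvaluation (λ (_ , b , _) → sum (map (λ j → hexDist j b) positions) ≡ᵇ 9) _ q q))

-- off k is the position, in hexagon k, of the cut vertex shared with
-- hexagon k+1; that vertex is position 0 of hexagon k+1.
-- climb off p d q : walk from position p of hexagon 0 to position q of
-- hexagon d, crossing every intermediate hexagon between its cut vertices.
climb : (ℕ → ℕ) → ℕ → ℕ → ℕ → ℕ
climb off p zero    q = hexDist p q
climb off p (suc d) q = hexDist p (off 0) + climb (off ∘ suc) 0 d q

chainDist : (ℕ → ℕ) → ℕ → ℕ → ℕ → ℕ → ℕ
chainDist off zero    p b       q = climb off p b q
chainDist off (suc a) p zero    q = climb off q (suc a) p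
chainDist off (suc a) p (suc b) q = chainDist (off ∘ suc) a p b q

climb-last : ∀ off p d r → climb off p (suc d) r ≡ climb off p d (off d) + hexDist 0 r
climb-last off p zero    r = refl
climb-last off p (suc d) r = begin
  hexDist p (off 0) + climb (off ∘ suc) 0 (suc d) r
    ≡⟨ cong (hexDist p (off 0) +_) (climb-last (off ∘ suc) 0 d r) ⟩
  hexDist p (off 0) + (climb (off ∘ suc) 0 d (off (suc d)) + hexDist 0 r)
    ≡⟨ +-assoc (hexDist p (off 0)) _ (hexDist 0 r) ⟨
  hexDist p (off 0) + climb (off ∘ suc) 0 d (off (suc d)) + hexDist 0 r ∎
  where open ≡-Reasoning

chainDist-sym : ∀ off a p b q → chainDist off a p b q ≡ chainDist off b q a p
chainDist-sym off zero    p zero    q = hexDist-sym p q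
chainDist-sym off zero    p (suc b) q = refl
chainDist-sym off (suc a) p zero    q = refl
chainDist-sym off (suc a) p (suc b) q = chainDist-sym (off ∘ suc) a p b q

chainDist-same : ∀ off a p q → chainDist off a p a q ≡ hexDist p q
chainDist-same off zero    p q = refl
chainDist-same off (suc a) p q = chainDist-same (off ∘ suc) a p q

chainDist-cut : ∀ off k b q → chainDist off k (off k) b q ≡ chainDist off (suc k) 0 b q
chainDist-cut off zero    zero    q = trans (hexDist-sym (off 0) q) (sym (+-identityʳ _))
chainDist-cut off zero    (suc b) q = cong (_+ climb (off ∘ suc) 0 b q) (hexDist-self (off 0))
chainDist-cut off (suc k) zero    q = sym (trans (climb-last off q (suc k) 0) (+-identityʳ _))
chainDist-cut off (suc k) (suc b) q = chainDist-cut (off ∘ suc) k b q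

chainDist-beyond : ∀ off a p b r → a ≤ b →
                   chainDist off a p (suc b) r ≡ chainDist off a p b (off b) + hexDist 0 r
chainDist-beyond off zero    p b       r _         = climb-last off p b r
chainDist-beyond off (suc a) p (suc b) r (s≤s a≤b) = chainDist-beyond (off ∘ suc) a p b r a≤b

-- How the distance to a fixed target (b , q) varies with the position i in
-- hexagon k: as the hexagon distance from i to the point of hexagon k
-- through which every geodesic to the target leaves it.
data Profile (off : ℕ → ℕ) (k b q : ℕ) : Set where
  sameHex : k ≡ b → (∀ i → chainDist off k i b q ≡ hexDist i q) → Profile off k b q
  aboveHex : k < b → (∀ i → chainDist off k i b q ≡ chainDist off (suc k) 0 b q + hexDist i (off k)) →
             Profile off k b q
  belowHex : b < k → (C : ℕ) → (∀ i → chainDist off k i b q ≡ C + hexDist i 0) → Profile off k b q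

profile : ∀ off k b q → Profile off k b q
profile off zero    zero    q = sameHex refl (λ i → refl)
profile off zero    (suc b) q = aboveHex z<s (λ i → +-comm (hexDist i (off 0)) _)
profile off (suc k) zero    q = belowHex z<s (climb off q k (off k))
  (λ i → trans (climb-last off q k i) (cong (climb off q k (off k) +_) (hexDist-sym 0 i)))
profile off (suc k) (suc b) q with profile (off ∘ suc) k b q
... | sameHex  k≡b f   = sameHex (cong suc k≡b) f
... | aboveHex k<b f   = aboveHex (s<s k<b) f
... | belowHex b<k C f = belowHex (s<s b<k) C f

-- every hexagon adds at most its diameter 3
chainDist≤ : ∀ off a p b q → chainDist off a p b q ≤ 3 + 3 * (a ⊔ b)
chainDist≤ off zero    p b       q = climb≤ off p b q
  where
  climb≤ : ∀ off p d q → climb off p d q ≤ 3 + 3 * d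
  climb≤ off p zero    q = hexDist≤3 p q
  climb≤ off p (suc d) q = begin
    hexDist p (off 0) + climb (off ∘ suc) 0 d q ≤⟨ +-mono-≤ (hexDist≤3 p (off 0)) (climb≤ (off ∘ suc) 0 d q) ⟩
    3 + (3 + 3 * d)                             ≡⟨ cong (3 +_) (*-suc 3 d) ⟨
    3 + 3 * suc d                               ∎
    where open ≤-Reasoning
chainDist≤ off (suc a) p zero    q = subst (λ m → chainDist off (suc a) p zero q ≤ 3 + 3 * m)
  (⊔-identityʳ (suc a)) (chainDist≤ off zero q (suc a) p)
chainDist≤ off (suc a) p (suc b) q = ≤-trans (chainDist≤ (off ∘ suc) a p b q)
  (+-monoʳ-≤ 3 (*-monoʳ-≤ 3 (n≤1+n (a ⊔ b))))

IsVertex : ℕ → ℕ → Set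
IsVertex n u = u < suc (5 * n)

loc : (ℕ → ℕ) → ℕ → ℕ → ℕ
loc off k zero    = c off k
loc off k (suc j) = 5 * k + suc j

hexOf posOf : ℕ → ℕ
hexOf u = pred u / 5
posOf zero    = 0
posOf (suc m) = suc (m % 5)

posOf≤5 : ∀ u → posOf u ≤ 5
posOf≤5 zero    = z≤n
posOf≤5 (suc m) = m%n<n m 5

loc-home : ∀ off u → u ≡ loc off (hexOf u) (posOf u)
loc-home off zero    = refl
loc-home off (suc m) = begin
  suc m                       ≡⟨ cong suc (m≡m%n+[m/n]*n m 5) ⟩
  suc (m % 5 + m / 5 * 5)     ≡⟨ cong suc (+-comm (m % 5) _) ⟩
  suc (m / 5 * 5 + m % 5)     ≡⟨ cong (λ x → suc (x + m % 5)) (*-comm (m / 5) 5) ⟩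
  suc (5 * (m / 5) + m % 5)   ≡⟨ +-suc (5 * (m / 5)) (m % 5) ⟨
  5 * (m / 5) + suc (m % 5)   ∎
  where open ≡-Reasoning

home-loc : ∀ k x → 1 ≤ x → x ≤ 5 → hexOf (5 * k + x) ≡ k × posOf (5 * k + x) ≡ x
home-loc k (suc j) _ (s≤s j≤4) rewrite +-suc (5 * k) j = hexOf-eq , cong suc posOf-eq
  where
  open ≡-Reasoning
  j<5 : j < 5
  j<5 = s≤s j≤4
  swap : 5 * k + j ≡ j + k * 5
  swap = trans (+-comm (5 * k) j) (cong (j +_) (*-comm 5 k))
  noCarry : j % 5 + k * 5 % 5 < 5
  noCarry = ≤-trans (≤-reflexive (cong suc (trans (cong₂ _+_ (m<n⇒m%n≡m j<5) (m*n%n≡0 k 5)) (+-identityʳ j)))) j<5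
  hexOf-eq : (5 * k + j) / 5 ≡ k
  hexOf-eq = begin
    (5 * k + j) / 5     ≡⟨ cong (_/ 5) swap ⟩
    (j + k * 5) / 5     ≡⟨ +-distrib-/ j (k * 5) noCarry ⟩
    j / 5 + k * 5 / 5   ≡⟨ cong₂ _+_ (m<n⇒m/n≡0 j<5) (m*n/n≡m k 5) ⟩
    k                   ∎
  posOf-eq : (5 * k + j) % 5 ≡ j
  posOf-eq = trans (cong (_% 5) swap) (trans ([m+kn]%n≡m%n j k 5) (m<n⇒m%n≡m j<5))

posOf≡0 : ∀ u → posOf u ≡ 0 → u ≡ 0
posOf≡0 zero _ = refl

hexOf< : ∀ {n u} → 1 ≤ n → IsVertex n u → hexOf u < n
hexOf< {n} {zero}  1≤n _          = 1≤n
hexOf< {n} {suc m} 1≤n (s≤s u≤5n) = m<n*o⇒m/o<n (subst (m <_) (*-comm 5 n) u≤5n)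

spiroDist : (ℕ → ℕ) → ℕ → ℕ → ℕ
spiroDist off u v = chainDist off (hexOf u) (posOf u) (hexOf v) (posOf v)

-- Inside a spiro chain, the distance from the vertex at position i of
-- hexagon k is given by those coordinates, even for the cut vertex c k.
spiroDist-loc : ∀ {n off} k i v → IsSpiroChain n off → k < n → i ≤ 5 →
                spiroDist off (loc off k i) v ≡ chainDist off k i (hexOf v) (posOf v)
spiroDist-loc k (suc j) v _ _ j<5 with home-loc k (suc j) (s≤s z≤n) j<5
... | hexOf≡ , posOf≡ rewrite hexOf≡ | posOf≡ = refl
spiroDist-loc zero    zero v _ _ _ = refl
spiroDist-loc {off = off} (suc k) zero v spiro k+1<n _ with spiro k k+1<n
... | 1≤off , off≤5 with home-loc k (off k) 1≤off off≤5
... | hexOf≡ , posOf≡ rewrite hexOf≡ | posOf≡ = chainDist-cut off k (hexOf v) (posOf v)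

lastOfHex≤ : ∀ {k n} → k < n → 5 * k + 5 ≤ 5 * n
lastOfHex≤ {k} {n} k<n = begin
  5 * k + 5   ≡⟨ +-comm (5 * k) 5 ⟩
  5 + 5 * k   ≡⟨ *-suc 5 k ⟨
  5 * suc k   ≤⟨ *-monoʳ-≤ 5 k<n ⟩
  5 * n       ∎
  where open ≤-Reasoning

loc-vertex : ∀ {n off} k i → IsSpiroChain n off → k < n → i ≤ 5 → IsVertex n (loc off k i)
loc-vertex zero    zero _ _ _ = s≤s z≤n
loc-vertex {off = off} (suc k) zero spiro k+1<n _ =
  s≤s (≤-trans (+-monoʳ-≤ (5 * k) (proj₂ (spiro k k+1<n))) (lastOfHex≤ (<⇒≤ k+1<n)))
loc-vertex k (suc j) _ k<n j<5 = s≤s (≤-trans (+-monoʳ-≤ (5 * k) j<5) (lastOfHex≤ k<n))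

spiroDist-self : ∀ off u → spiroDist off u u ≡ 0
spiroDist-self off u = trans (chainDist-same off (hexOf u) (posOf u) (posOf u)) (hexDist-self (posOf u))

chainDist-above≡0 : ∀ off a p b q → a < b → q ≤ 5 → chainDist off a p b q ≡ 0 → q ≡ 0
chainDist-above≡0 off a p (suc b) q (s≤s a≤b) q≤5 e rewrite chainDist-beyond off a p b q a≤b =
  sym (hexDist≡0 z≤n q≤5 (m+n≡0⇒n≡0 (chainDist off a p b (off b)) e))


spiroDist≡0 : ∀ off u v → spiroDist off u v ≡ 0 → u ≡ v
spiroDist≡0 off u v e with <-cmp (hexOf u) (hexOf v)
... | tri≈ _ same _ = begin
  u                             ≡⟨ loc-home off u ⟩
  loc off (hexOf u) (posOf u)   ≡⟨ cong₂ (loc off) same samePos ⟩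
  loc off (hexOf v) (posOf v)   ≡⟨ loc-home off v ⟨
  v                             ∎
  where
  open ≡-Reasoning
  samePos : posOf u ≡ posOf v
  samePos = hexDist≡0 (posOf≤5 u) (posOf≤5 v) (begin
    hexDist (posOf u) (posOf v)                           ≡⟨ chainDist-same off (hexOf u) (posOf u) (posOf v) ⟨
    chainDist off (hexOf u) (posOf u) (hexOf u) (posOf v) ≡⟨ cong (λ b → chainDist off (hexOf u) (posOf u) b (posOf v)) same ⟩
    spiroDist off u v                                     ≡⟨ e ⟩
    0                                                     ∎)
... | tri< below _ _ = ⊥-elim (<⇒≢ (≤-<-trans z≤n below) (sym (cong hexOf
        (posOf≡0 v (chainDist-above≡0 off (hexOf u) (posOf u) (hexOf v) (posOf v) below (posOf≤5 v) e)))))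
... | tri> _ _ above = ⊥-elim (<⇒≢ (≤-<-trans z≤n above) (sym (cong hexOf
        (posOf≡0 u (chainDist-above≡0 off (hexOf v) (posOf v) (hexOf u) (posOf u) above (posOf≤5 u)
          (trans (chainDist-sym off (hexOf v) (posOf v) (hexOf u) (posOf u)) e))))))

joins : ℕ → ℕ → ℕ × ℕ → Bool
joins u w (a , b) = ((a ≡ᵇ u) ∧ (b ≡ᵇ w)) ∨ ((a ≡ᵇ w) ∧ (b ≡ᵇ u))

hexEdge∈ : ∀ off k i → i ≤ 5 → (loc off k i , loc off k (next i)) ∈ hexEdges off k
hexEdge∈ off k 0 _ = here refl
hexEdge∈ off k 1 _ = there (here refl)
hexEdge∈ off k 2 _ = there (there (here refl))
hexEdge∈ off k 3 _ = there (there (there (here refl)))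
hexEdge∈ off k 4 _ = there (there (there (there (here refl))))
hexEdge∈ off k 5 _ = there (there (there (there (there (here refl)))))
hexEdge∈ off k (suc (suc (suc (suc (suc (suc _)))))) (s≤s (s≤s (s≤s (s≤s (s≤s ())))))

hexEdge-shape : ∀ {off k e} → e ∈ hexEdges off k → ∃[ i ] i ≤ 5 × e ≡ (loc off k i , loc off k (next i))
hexEdge-shape (here refl)                                         = 0 , z≤n , refl
hexEdge-shape (there (here refl))                                 = 1 , s≤s z≤n , refl
hexEdge-shape (there (there (here refl)))                         = 2 , s≤s (s≤s z≤n) , refl
hexEdge-shape (there (there (there (here refl))))                 = 3 , s≤s (s≤s (s≤s z≤n)) , refl
hexEdge-shape (there (there (there (there (here refl)))))         = 4 , s≤s (s≤s (s≤s (s≤s z≤n))) , refl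
hexEdge-shape (there (there (there (there (there (here refl)))))) = 5 , s≤s (s≤s (s≤s (s≤s (s≤s z≤n)))) , refl

record HexNeighbours (n : ℕ) (off : ℕ → ℕ) (u w : ℕ) : Set where
  constructor neighbours
  field
    hex   : ℕ
    pos   : ℕ
    hex<n : hex < n
    pos≤5 : pos ≤ 5
    u≡    : u ≡ loc off hex pos
    w≡    : w ≡ loc off hex (next pos) ⊎ w ≡ loc off hex (prev pos)

adj⇒neighbours : ∀ {n off u w} → T (adj n off u w) → HexNeighbours n off u w
adj⇒neighbours {n} {off} {u} {w} isAdj
  with find (concatMap⁻ (hexEdges off) (any⁻ (joins u w) (edges n off) isAdj))
... | k , k∈ , inHex with find inHex
... | _ , e∈ , joined with hexEdge-shape {off} {k} e∈
... | i , i≤5 , refl with to T-∨ joined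
... | inj₁ forward = let a , b = to T-∧ forward in
  neighbours k i (∈-upTo⁻ k∈) i≤5 (sym (≡ᵇ⇒≡ _ _ a)) (inj₁ (sym (≡ᵇ⇒≡ _ _ b)))
... | inj₂ backward = let a , b = to T-∧ backward in
  neighbours k (next i) (∈-upTo⁻ k∈) (next≤5 i) (sym (≡ᵇ⇒≡ _ _ b))
    (inj₂ (trans (sym (≡ᵇ⇒≡ _ _ a)) (cong (loc off k) (sym (prev-next i i≤5)))))

hexEdge-adj : ∀ {n off k} a b → k < n → (a , b) ∈ hexEdges off k → T (adj n off a b) × T (adj n off b a)
hexEdge-adj {n} {off} a b k<n e∈ = listed (from T-∨ (inj₁ itself)) , listed (from T-∨ (inj₂ itself))
  where
  itself : T ((a ≡ᵇ a) ∧ (b ≡ᵇ b))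
  itself = from T-∧ (≡⇒≡ᵇ a a refl , ≡⇒≡ᵇ b b refl)
  listed : ∀ {x y} → T (joins x y (a , b)) → T (adj n off x y)
  listed {x} {y} ok = any⁺ (joins x y) (concatMap⁺ (hexEdges off) (lose (∈-upTo⁺ k<n) (lose e∈ ok)))

next-adj : ∀ {n} off k i → k < n → i ≤ 5 → T (adj n off (loc off k i) (loc off k (next i)))
next-adj off k i k<n i≤5 = proj₁ (hexEdge-adj _ _ k<n (hexEdge∈ off k i i≤5))

prev-adj : ∀ {n} off k i → k < n → i ≤ 5 → T (adj n off (loc off k i) (loc off k (prev i)))
prev-adj off k i k<n i≤5 = proj₂ (hexEdge-adj _ _ k<n
  (subst (λ j → (loc off k (prev i) , loc off k j) ∈ hexEdges off k) (next-prev i i≤5) (hexEdge∈ off k (prev i) (prev≤5 i))))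

shifted : ∀ C {x y} → x ≤ suc y → C + x ≤ suc (C + y)
shifted C {x} {y} x≤y+1 = subst (C + x ≤_) (+-suc C y) (+-monoʳ-≤ C x≤y+1)

chainDist-step : ∀ off k b q i j → (∀ x → hexDist i x ≤ suc (hexDist j x)) →
                 chainDist off k i b q ≤ suc (chainDist off k j b q)
chainDist-step off k b q i j lip with profile off k b q
... | sameHex _ f rewrite f i | f j = lip q
... | aboveHex _ f rewrite f i | f j = shifted (chainDist off (suc k) 0 b q) (lip (off k))
... | belowHex _ C f rewrite f i | f j = shifted C (lip 0)

spiroDist-lip : ∀ {n off u w} v → IsSpiroChain n off → T (adj n off u w) →
                spiroDist off u v ≤ suc (spiroDist off w v)
spiroDist-lip {n} {off} {u} {w} v spiro isAdj with adj⇒neighbours {n} {off} {u} {w} isAdj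
... | neighbours k i k<n i≤5 refl (inj₁ refl)
  rewrite spiroDist-loc k i v spiro k<n i≤5 | spiroDist-loc k (next i) v spiro k<n (next≤5 i) =
  chainDist-step off k (hexOf v) (posOf v) i (next i) (hexDist-next i)
... | neighbours k i k<n i≤5 refl (inj₂ refl)
  rewrite spiroDist-loc k i v spiro k<n i≤5 | spiroDist-loc k (prev i) v spiro k<n (prev≤5 i) =
  chainDist-step off k (hexOf v) (posOf v) i (prev i) (hexDist-prev i)

record StepTowards (n : ℕ) (off : ℕ → ℕ) (u v m : ℕ) : Set where
  constructor stepTo
  field
    w        : ℕ
    w-vertex : IsVertex n w
    w-adj    : T (adj n off u w)
    w-dist   : spiroDist off w v ≡ m

descend-in-hex : ∀ {n off K I v C X r m} → IsSpiroChain n off → K < n → I ≤ 5 →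
                 (∀ i → chainDist off K i (hexOf v) (posOf v) ≡ C + hexDist i X) →
                 hexDist I X ≡ suc r → chainDist off K I (hexOf v) (posOf v) ≡ suc m →
                 StepTowards n off (loc off K I) v m
descend-in-hex {n} {off} {K} {I} {v} {C} {X} {r} {m} spiro K<n I≤5 f e d =
  [ via (next I) (next≤5 I) (next-adj off K I K<n I≤5) , via (prev I) (prev≤5 I) (prev-adj off K I K<n I≤5) ]′
  (hexDist-descent I X r e)
  where
  C+r≡m : C + r ≡ m
  C+r≡m = suc-injective (trans (sym (+-suc C r)) (trans (cong (C +_) (sym e)) (trans (sym (f I)) d)))
  via : ∀ j → j ≤ 5 → T (adj n off (loc off K I) (loc off K j)) → hexDist j X ≡ r → StepTowards n off (loc off K I) v m
  via j j≤5 isAdj closer = stepTo (loc off K j) (loc-vertex K j spiro K<n j≤5) isAdj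
    (trans (spiroDist-loc K j v spiro K<n j≤5) (trans (f j) (trans (cong (C +_) closer) C+r≡m)))

-- position x ≥ 1 of hexagon k is the vertex 5k+x (also for x = off k, where it is c (k+1))
loc-pos : ∀ off k x → 1 ≤ x → loc off k x ≡ 5 * k + x
loc-pos off k (suc x) _ = refl

descend-from-cut : ∀ {n off v m} K → IsSpiroChain n off → 1 ≤ n → IsVertex n v → K < hexOf v →
                   chainDist off (suc K) 0 (hexOf v) (posOf v) ≡ suc m → StepTowards n off (loc off (suc K) 0) v m
descend-from-cut {n} {off} {v} {m} K spiro 1≤n v∈ K<b e with profile off (suc K) (hexOf v) (posOf v)
... | sameHex K+1≡b f =
  descend-in-hex {X = posOf v} spiro (subst (_< n) (sym K+1≡b) (hexOf< 1≤n v∈)) z≤n f (trans (sym (f 0)) e) e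
... | belowHex b<K+1 _ _ = ⊥-elim (<⇒≱ K<b (s≤s⁻¹ b<K+1))
... | aboveHex K+1<b f with spiro (suc K) (≤-<-trans K+1<b (hexOf< 1≤n v∈))
...   | 1≤off , off≤5 with hexDist 0 (off (suc K)) in eq
...     | zero  = ⊥-elim (<⇒≢ 1≤off (hexDist≡0 z≤n off≤5 eq))
...     | suc _ = descend-in-hex spiro (<-trans (n<1+n (suc K)) (≤-<-trans K+1<b (hexOf< 1≤n v∈))) z≤n f eq e

descend : ∀ {n off u v m} → IsSpiroChain n off → 1 ≤ n → IsVertex n u → IsVertex n v →
          spiroDist off u v ≡ suc m → StepTowards n off u v m
descend {n} {off} {u} {v} {m} spiro 1≤n u∈ v∈ e =
  subst (λ x → StepTowards n off x v m) (sym (loc-home off u)) (fromHome (profile off K (hexOf v) (posOf v)))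
  where
  K = hexOf u
  I = posOf u
  K<n : K < n
  K<n = hexOf< 1≤n u∈
  fromHome : Profile off K (hexOf v) (posOf v) → StepTowards n off (loc off K I) v m
  fromHome (sameHex _ f) = descend-in-hex {X = posOf v} spiro K<n (posOf≤5 u) f (trans (sym (f I)) e) e
  fromHome (belowHex b<K C f) with hexDist I 0 in eq
  ... | zero  = ⊥-elim (<⇒≢ (≤-<-trans z≤n b<K) (sym (cong hexOf (posOf≡0 u (hexDist≡0 (posOf≤5 u) z≤n eq)))))
  ... | suc _ = descend-in-hex {X = 0} spiro K<n (posOf≤5 u) f eq e
  fromHome (aboveHex K<b f) with spiro K (≤-<-trans K<b (hexOf< 1≤n v∈)) | hexDist I (off K) in eq
  ... | _ | suc _ = descend-in-hex spiro K<n (posOf≤5 u) f eq e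
  ... | 1≤off , off≤5 | zero = subst (λ x → StepTowards n off x v m) atExit (descend-from-cut K spiro 1≤n v∈ K<b exitDist)
    where
    C = chainDist off (suc K) 0 (hexOf v) (posOf v)
    exitDist : C ≡ suc m
    exitDist = trans (sym (+-identityʳ C)) (trans (cong (C +_) (sym eq)) (trans (sym (f I)) e))
    -- u is the exit cut vertex of its home hexagon, i.e. position 0 of hexagon K+1
    atExit : loc off (suc K) 0 ≡ loc off K I
    atExit = trans (sym (loc-pos off K (off K) 1≤off)) (cong (loc off K) (sym (hexDist≡0 (posOf≤5 u) off≤5 eq)))

reach-sound : ∀ {n off} k u v → IsSpiroChain n off → T (reach n off k u v) → spiroDist off u v ≤ k
reach-sound {off = off} zero u v _ u≡v rewrite ≡ᵇ⇒≡ u v u≡v | spiroDist-self off v = z≤n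
reach-sound {n} {off} (suc k) u v spiro walk with to T-∨ walk
... | inj₁ shorter = m≤n⇒m≤1+n (reach-sound k u v spiro shorter)
... | inj₂ viaNeighbour with find (any⁻ (λ x → adj n off u x ∧ reach n off k x v) (vertices n) viaNeighbour)
... | w , _ , firstStep = let isAdj , rest = to T-∧ firstStep in
  ≤-trans (spiroDist-lip v spiro isAdj) (s≤s (reach-sound k w v spiro rest))

reach-complete : ∀ {n off} k u v → IsSpiroChain n off → 1 ≤ n → IsVertex n u → IsVertex n v →
                 spiroDist off u v ≤ k → T (reach n off k u v)
reach-complete {off = off} zero u v _ _ _ _ d≤0 rewrite spiroDist≡0 off u v (n≤0⇒n≡0 d≤0) = ≡⇒≡ᵇ v v refl
reach-complete {n} {off} (suc k) u v spiro 1≤n u∈ v∈ d≤k+1 with spiroDist off u v ≤? k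
... | yes d≤k = from T-∨ (inj₁ (reach-complete k u v spiro 1≤n u∈ v∈ d≤k))
... | no d≰k with descend spiro 1≤n u∈ v∈ (≤-antisym d≤k+1 (≰⇒> d≰k))
... | stepTo w w∈ isAdj w-dist = from (T-∨ {reach n off k u v}) (inj₂ (any⁺ (λ x → adj n off u x ∧ reach n off k x v)
        (lose (∈-upTo⁺ w∈) (from T-∧ (isAdj , reach-complete k w v spiro 1≤n w∈ v∈ (≤-reflexive w-dist))))))

searchDist-spiro : ∀ {n off} u v s fuel → IsSpiroChain n off → 1 ≤ n → IsVertex n u → IsVertex n v →
                   s ≤ spiroDist off u v → spiroDist off u v ≤ s + fuel → searchDist n off u v s fuel ≡ spiroDist off u v
searchDist-spiro {off = off} u v s zero _ _ _ _ s≤d d≤s+0 = ≤-antisym s≤d (subst (spiroDist off u v ≤_) (+-identityʳ s) d≤s+0)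
searchDist-spiro {n} {off} u v s (suc fuel) spiro 1≤n u∈ v∈ s≤d d≤s+fuel with reach n off s u v in found
... | true  = ≤-antisym s≤d (reach-sound s u v spiro (subst T (sym found) _))
... | false = searchDist-spiro u v (suc s) fuel spiro 1≤n u∈ v∈ s<d (subst (spiroDist off u v ≤_) (+-suc s fuel) d≤s+fuel)
  where
  s<d : s < spiroDist off u v
  s<d with spiroDist off u v ≤? s
  ... | no d≰s = ≰⇒> d≰s
  ... | yes d≤s = ⊥-elim (subst T found (reach-complete s u v spiro 1≤n u∈ v∈ d≤s))

spiroDist≤ : ∀ {n} off u v → 1 ≤ n → IsVertex n u → IsVertex n v → spiroDist off u v ≤ length (vertices n)
spiroDist≤ {suc n'} off u v 1≤n u∈ v∈ = begin
  spiroDist off u v          ≤⟨ chainDist≤ off (hexOf u) (posOf u) (hexOf v) (posOf v) ⟩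
  3 + 3 * (hexOf u ⊔ hexOf v) ≤⟨ +-monoʳ-≤ 3 (*-monoʳ-≤ 3 (⊔-lub (s≤s⁻¹ (hexOf< 1≤n u∈)) (s≤s⁻¹ (hexOf< 1≤n v∈)))) ⟩
  3 + 3 * n'                 ≤⟨ +-mono-≤ (≤ᵇ⇒≤ 3 5 _) (*-monoˡ-≤ n' (≤ᵇ⇒≤ 3 5 _)) ⟩
  5 + 5 * n'                 ≡⟨ *-suc 5 n' ⟨
  5 * suc n'                 ≤⟨ n≤1+n _ ⟩
  suc (5 * suc n')           ≡⟨ length-upTo _ ⟨
  length (vertices (suc n')) ∎
  where open ≤-Reasoning

dist≡spiroDist : ∀ {n off} u v → IsSpiroChain n off → 1 ≤ n → IsVertex n u → IsVertex n v →
                 dist n off u v ≡ spiroDist off u v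
dist≡spiroDist {n} {off} u v spiro 1≤n u∈ v∈ =
  searchDist-spiro u v 0 (length (vertices n)) spiro 1≤n u∈ v∈ z≤n (spiroDist≤ off u v 1≤n u∈ v∈)

sumMap : {A : Set} → (A → ℕ) → List A → ℕ
sumMap f xs = sum (map f xs)

module _ {A : Set} where

  sumMap-++ : ∀ (f : A → ℕ) xs ys → sumMap f (xs ++ ys) ≡ sumMap f xs + sumMap f ys
  sumMap-++ f xs ys = trans (cong sum (map-++ f xs ys)) (sum-++ (map f xs) (map f ys))

  sumMap-cong : ∀ {f g : A → ℕ} xs → (∀ {x} → x ∈ xs → f x ≡ g x) → sumMap f xs ≡ sumMap g xs
  sumMap-cong []       _  = refl
  sumMap-cong (x ∷ xs) eq = cong₂ _+_ (eq (here refl)) (sumMap-cong xs (eq ∘ there))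

  sumMap-+ : ∀ (f g : A → ℕ) xs → sumMap (λ x → f x + g x) xs ≡ sumMap f xs + sumMap g xs
  sumMap-+ f g []       = refl
  sumMap-+ f g (x ∷ xs) rewrite sumMap-+ f g xs = interchange (f x) (g x) (sumMap f xs) (sumMap g xs)

  sumMap-const : ∀ k (xs : List A) → sumMap (λ _ → k) xs ≡ k * length xs
  sumMap-const k []       = sym (*-zeroʳ k)
  sumMap-const k (x ∷ xs) rewrite sumMap-const k xs = sym (*-suc k (length xs))

  sumMap-* : ∀ k (f : A → ℕ) xs → sumMap (λ x → k * f x) xs ≡ k * sumMap f xs
  sumMap-* k f []       = sym (*-zeroʳ k)
  sumMap-* k f (x ∷ xs) rewrite sumMap-* k f xs = sym (*-distribˡ-+ k (f x) _)

  sum-concatMap : ∀ (F : A → List ℕ) xs → sum (concatMap F xs) ≡ sumMap (sum ∘ F) xs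
  sum-concatMap F []       = refl
  sum-concatMap F (x ∷ xs) = trans (sum-++ (F x) (concatMap F xs)) (cong (sum (F x) +_) (sum-concatMap F xs))

sumMap-map : ∀ {A B : Set} (f : B → ℕ) (g : A → B) xs → sumMap f (map g xs) ≡ sumMap (f ∘ g) xs
sumMap-map f g xs = cong sum (sym (map-∘ xs))

newVertices : ℕ → List ℕ
newVertices N = map (λ j → 5 * N + suc j) (upTo 5)

upTo-+ : ∀ m k → upTo (m + k) ≡ upTo m ++ applyUpTo (m +_) k
upTo-+ m zero    = trans (cong upTo (+-identityʳ m)) (sym (++-identityʳ (upTo m)))
upTo-+ m (suc k) = begin
  upTo (m + suc k)                              ≡⟨ cong upTo (+-suc m k) ⟩
  upTo (suc (m + k))                            ≡⟨ upTo-∷ʳ (m + k) ⟨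
  upTo (m + k) ∷ʳ (m + k)                       ≡⟨ cong (_∷ʳ (m + k)) (upTo-+ m k) ⟩
  (upTo m ++ applyUpTo (m +_) k) ∷ʳ (m + k)     ≡⟨ ++-assoc (upTo m) _ _ ⟩
  upTo m ++ (applyUpTo (m +_) k ∷ʳ (m + k))     ≡⟨ cong (upTo m ++_) (applyUpTo-∷ʳ (m +_) k) ⟩
  upTo m ++ applyUpTo (m +_) (suc k)            ∎
  where open ≡-Reasoning

vertices-suc : ∀ N → vertices (suc N) ≡ vertices N ++ newVertices N
vertices-suc N = begin
  upTo (suc (5 * suc N))                          ≡⟨ cong (upTo ∘ suc) (trans (*-suc 5 N) (+-comm 5 (5 * N))) ⟩
  upTo (suc (5 * N) + 5)                          ≡⟨ upTo-+ (suc (5 * N)) 5 ⟩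
  vertices N ++ applyUpTo (suc (5 * N) +_) 5      ≡⟨ cong (vertices N ++_) (sym (map-upTo (suc (5 * N) +_) 5)) ⟩
  vertices N ++ map (suc (5 * N) +_) (upTo 5)     ≡⟨ cong (vertices N ++_) (map-cong (λ j → sym (+-suc (5 * N) j)) (upTo 5)) ⟩
  vertices N ++ newVertices N                     ∎
  where open ≡-Reasoning

spiro-prefix : ∀ {m n off} → m ≤ n → IsSpiroChain n off → IsSpiroChain m off
spiro-prefix m≤n spiro k k+1<m = spiro k (<-≤-trans k+1<m m≤n)

via-cut : ∀ {N off u y} → IsSpiroChain (suc N) off → IsVertex N u → hexOf y ≡ N →
          spiroDist off u y ≡ spiroDist off u (c off N) + hexDist 0 (posOf y)
via-cut {zero} {off} {zero} {y} _ _ hexOf-y rewrite hexOf-y = refl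
via-cut {zero} {u = suc _} _ (s≤s ()) _
via-cut {suc N} {off} {u} {y} spiro u∈ hexOf-y with spiro N ≤-refl
... | 1≤off , off≤5 with home-loc N (off N) 1≤off off≤5
... | hexOf-c , posOf-c = begin
  chainDist off (hexOf u) (posOf u) (hexOf y) (posOf y)
    ≡⟨ cong (λ b → chainDist off (hexOf u) (posOf u) b (posOf y)) hexOf-y ⟩
  chainDist off (hexOf u) (posOf u) (suc N) (posOf y)
    ≡⟨ chainDist-beyond off (hexOf u) (posOf u) N (posOf y) (s≤s⁻¹ (hexOf< (s≤s z≤n) u∈)) ⟩
  chainDist off (hexOf u) (posOf u) N (off N) + hexDist 0 (posOf y)
    ≡⟨ cong (_+ hexDist 0 (posOf y)) (sym (cong₂ (chainDist off (hexOf u) (posOf u)) hexOf-c posOf-c)) ⟩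
  spiroDist off u (c off (suc N)) + hexDist 0 (posOf y) ∎
  where open ≡-Reasoning

<ᵇ-true : ∀ {u v} → u < v → (u <ᵇ v) ≡ true
<ᵇ-true u<v = to T-≡ (<⇒<ᵇ u<v)

<ᵇ-false : ∀ {u v} → v ≤ u → (u <ᵇ v) ≡ false
<ᵇ-false {u} {v} v≤u with u <ᵇ v in e
... | false = refl
... | true  = ⊥-elim (≤⇒≯ v≤u (<ᵇ⇒< u v (subst T (sym e) _)))

<ᵇ-shift : ∀ a i j → (a + suc i <ᵇ a + suc j) ≡ (i <ᵇ j)
<ᵇ-shift zero    i j = refl
<ᵇ-shift (suc a) i j = <ᵇ-shift a i j

pairSum : (ℕ → ℕ) → ℕ → List ℕ → ℕ
pairSum off u L = sumMap (λ v → if u <ᵇ v then spiroDist off u v else 0) L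

wienerSum : ℕ → (ℕ → ℕ) → ℕ
wienerSum N off = sumMap (λ u → pairSum off u (vertices N)) (vertices N)

cutSum : ℕ → (ℕ → ℕ) → ℕ
cutSum N off = sumMap (λ u → spiroDist off u (c off N)) (vertices N)

old<new : ∀ N j → suc (5 * N) ≤ 5 * N + suc j
old<new N j = ≤-trans (s≤s (m≤m+n (5 * N) j)) (≤-reflexive (sym (+-suc (5 * N) j)))

home-new : ∀ N {j} → j ∈ upTo 5 → hexOf (5 * N + suc j) ≡ N × posOf (5 * N + suc j) ≡ suc j
home-new N j∈ = home-loc N _ (s≤s z≤n) (∈-upTo⁻ j∈)

-- an old vertex u sees the new ones through c N: five times d(u, c N),
-- plus the distances 1+2+3+2+1 inside hexagon N
pairSum-old-new : ∀ {N off u} → IsSpiroChain (suc N) off → IsVertex N u →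
                  pairSum off u (newVertices N) ≡ 5 * spiroDist off u (c off N) + 9
pairSum-old-new {N} {off} {u} spiro u∈ = begin
  pairSum off u (newVertices N)
    ≡⟨ sumMap-map (λ v → if u <ᵇ v then spiroDist off u v else 0) (λ j → 5 * N + suc j) (upTo 5) ⟩
  sumMap (λ j → if u <ᵇ 5 * N + suc j then spiroDist off u (5 * N + suc j) else 0) (upTo 5)
    ≡⟨ sumMap-cong (upTo 5) throughCut ⟩
  sumMap (λ j → d + hexDist 0 (suc j)) (upTo 5)
    ≡⟨ sumMap-+ (λ _ → d) (λ j → hexDist 0 (suc j)) (upTo 5) ⟩
  sumMap (λ _ → d) (upTo 5) + 9
    ≡⟨ cong (_+ 9) (sumMap-const d (upTo 5)) ⟩
  d * 5 + 9
    ≡⟨ cong (_+ 9) (*-comm d 5) ⟩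
  5 * d + 9 ∎
  where
  open ≡-Reasoning
  d = spiroDist off u (c off N)
  throughCut : ∀ {j} → j ∈ upTo 5 →
               (if u <ᵇ 5 * N + suc j then spiroDist off u (5 * N + suc j) else 0) ≡ d + hexDist 0 (suc j)
  throughCut {j} j∈ rewrite <ᵇ-true (≤-trans u∈ (old<new N j)) =
    trans (via-cut spiro u∈ (proj₁ (home-new N j∈))) (cong (λ p → d + hexDist 0 p) (proj₂ (home-new N j∈)))

-- new vertices come after all old ones, so their pair sums over G_N vanish
pairSum-new-old : ∀ off N j → pairSum off (5 * N + suc j) (vertices N) ≡ 0
pairSum-new-old off N j = trans (sumMap-cong (vertices N) later) (sumMap-const 0 (vertices N))
  where
  later : ∀ {v} → v ∈ vertices N → (if 5 * N + suc j <ᵇ v then spiroDist off (5 * N + suc j) v else 0) ≡ 0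
  later v∈ rewrite <ᵇ-false (≤-trans (s≤s⁻¹ (∈-upTo⁻ v∈)) (m≤m+n (5 * N) (suc j))) = refl

-- the pairs inside the new hexagon avoiding c N: 27 - 9 = 18
pairSum-new-new : ∀ off N → sumMap (λ u → pairSum off u (newVertices N)) (newVertices N) ≡ 18
pairSum-new-new off N = begin
  sumMap (λ u → pairSum off u (newVertices N)) (newVertices N)
    ≡⟨ sumMap-map (λ u → pairSum off u (newVertices N)) new (upTo 5) ⟩
  sumMap (λ i → pairSum off (new i) (newVertices N)) (upTo 5)
    ≡⟨ sumMap-cong (upTo 5) (λ {i} i∈ →
         trans (sumMap-map (λ v → if new i <ᵇ v then spiroDist off (new i) v else 0) new (upTo 5))
               (sumMap-cong (upTo 5) (insideHex i∈))) ⟩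
  sumMap (λ i → sumMap (λ j → if i <ᵇ j then hexDist (suc i) (suc j) else 0) (upTo 5)) (upTo 5)
    ≡⟨⟩
  18 ∎
  where
  open ≡-Reasoning
  new : ℕ → ℕ
  new j = 5 * N + suc j
  insideHex : ∀ {i j} → i ∈ upTo 5 → j ∈ upTo 5 →
              (if new i <ᵇ new j then spiroDist off (new i) (new j) else 0) ≡ (if i <ᵇ j then hexDist (suc i) (suc j) else 0)
  insideHex {i} {j} i∈ j∈ with home-new N i∈ | home-new N j∈
  ... | hexOf-i , posOf-i | hexOf-j , posOf-j
    rewrite <ᵇ-shift (5 * N) i j | hexOf-i | posOf-i | hexOf-j | posOf-j | chainDist-same off N (suc i) (suc j) = refl

wienerSum-suc : ∀ {N off} → IsSpiroChain (suc N) off →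
                wienerSum (suc N) off ≡ wienerSum N off + (5 * cutSum N off + 9 * suc (5 * N)) + 18
wienerSum-suc {N} {off} spiro = begin
  wienerSum (suc N) off
    ≡⟨ cong (λ L → sumMap (λ u → pairSum off u L) L) (vertices-suc N) ⟩
  sumMap (λ u → pairSum off u (A ++ B)) (A ++ B)
    ≡⟨ sumMap-cong (A ++ B) (λ {u} _ → sumMap-++ (λ v → if u <ᵇ v then spiroDist off u v else 0) A B) ⟩
  sumMap (λ u → pairSum off u A + pairSum off u B) (A ++ B)
    ≡⟨ sumMap-++ _ A B ⟩
  sumMap (λ u → pairSum off u A + pairSum off u B) A + sumMap (λ u → pairSum off u A + pairSum off u B) B
    ≡⟨ cong₂ _+_ (sumMap-+ (λ u → pairSum off u A) (λ u → pairSum off u B) A)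
                 (sumMap-+ (λ u → pairSum off u A) (λ u → pairSum off u B) B) ⟩
  (wienerSum N off + sumMap (λ u → pairSum off u B) A) + (sumMap (λ u → pairSum off u A) B + sumMap (λ u → pairSum off u B) B)
    ≡⟨ cong₂ (λ x y → (wienerSum N off + x) + y) oldToNew (cong₂ _+_ newToOld (pairSum-new-new off N)) ⟩
  wienerSum N off + (5 * cutSum N off + 9 * suc (5 * N)) + 18 ∎
  where
  open ≡-Reasoning
  A = vertices N
  B = newVertices N
  oldToNew : sumMap (λ u → pairSum off u B) A ≡ 5 * cutSum N off + 9 * suc (5 * N)
  oldToNew = begin
    sumMap (λ u → pairSum off u B) A
      ≡⟨ sumMap-cong A (λ u∈ → pairSum-old-new spiro (∈-upTo⁻ u∈)) ⟩
    sumMap (λ u → 5 * spiroDist off u (c off N) + 9) A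
      ≡⟨ sumMap-+ (λ u → 5 * spiroDist off u (c off N)) (λ _ → 9) A ⟩
    sumMap (λ u → 5 * spiroDist off u (c off N)) A + sumMap (λ _ → 9) A
      ≡⟨ cong₂ _+_ (sumMap-* 5 (λ u → spiroDist off u (c off N)) A)
                   (trans (sumMap-const 9 A) (cong (9 *_) (length-upTo (suc (5 * N))))) ⟩
    5 * cutSum N off + 9 * suc (5 * N) ∎
  newToOld : sumMap (λ u → pairSum off u A) B ≡ 0
  newToOld = trans (sumMap-map (λ u → pairSum off u A) (λ j → 5 * N + suc j) (upTo 5))
                   (trans (sumMap-cong (upTo 5) (λ {j} _ → pairSum-new-old off N j)) (sumMap-const 0 (upTo 5)))

cutSum-suc : ∀ {N off} → IsSpiroChain (suc (suc N)) off →
             cutSum (suc N) off + hexDist 0 (off N) ≡ cutSum N off + hexDist 0 (off N) * suc (5 * N) + 9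
cutSum-suc {N} {off} spiro with spiro N ≤-refl
... | 1≤off , off≤5 with home-loc N (off N) 1≤off off≤5
... | hexOf-c , posOf-c = begin
  cutSum (suc N) off + t
    ≡⟨ cong (λ L → sumMap (λ u → spiroDist off u c') L + t) (vertices-suc N) ⟩
  sumMap (λ u → spiroDist off u c') (A ++ B) + t
    ≡⟨ cong (_+ t) (sumMap-++ (λ u → spiroDist off u c') A B) ⟩
  sumMap (λ u → spiroDist off u c') A + sumMap (λ u → spiroDist off u c') B + t
    ≡⟨ +-assoc (sumMap (λ u → spiroDist off u c') A) _ t ⟩
  sumMap (λ u → spiroDist off u c') A + (sumMap (λ u → spiroDist off u c') B + t)
    ≡⟨ cong₂ _+_ fromOld fromNew ⟩
  cutSum N off + t * suc (5 * N) + 9 ∎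
  where
  open ≡-Reasoning
  A = vertices N
  B = newVertices N
  t = hexDist 0 (off N)
  c' = c off (suc N)
  fromOld : sumMap (λ u → spiroDist off u c') A ≡ cutSum N off + t * suc (5 * N)
  fromOld = begin
    sumMap (λ u → spiroDist off u c') A
      ≡⟨ sumMap-cong A (λ {u} u∈ → trans (via-cut (spiro-prefix (n≤1+n _) spiro) (∈-upTo⁻ u∈) hexOf-c)
                                         (cong (λ p → spiroDist off u (c off N) + hexDist 0 p) posOf-c)) ⟩
    sumMap (λ u → spiroDist off u (c off N) + t) A
      ≡⟨ sumMap-+ (λ u → spiroDist off u (c off N)) (λ _ → t) A ⟩
    cutSum N off + sumMap (λ _ → t) A
      ≡⟨ cong (cutSum N off +_) (trans (sumMap-const t A) (cong (t *_) (length-upTo (suc (5 * N))))) ⟩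
    cutSum N off + t * suc (5 * N) ∎
  fromNew : sumMap (λ u → spiroDist off u c') B + t ≡ 9
  fromNew = begin
    sumMap (λ u → spiroDist off u c') B + t
      ≡⟨ cong (_+ t) (sumMap-map (λ u → spiroDist off u c') (λ j → 5 * N + suc j) (upTo 5)) ⟩
    sumMap (λ j → spiroDist off (5 * N + suc j) c') (upTo 5) + t
      ≡⟨ cong (_+ t) (sumMap-cong (upTo 5) insideHex) ⟩
    sumMap (λ j → hexDist (suc j) (off N)) (upTo 5) + t
      ≡⟨ +-comm _ t ⟩
    sum (map (λ j → hexDist j (off N)) positions)
      ≡⟨ hexDist-total (off N) ⟩
    9 ∎
    where
    insideHex : ∀ {j} → j ∈ upTo 5 → spiroDist off (5 * N + suc j) c' ≡ hexDist (suc j) (off N)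
    insideHex j∈ with home-new N j∈
    ... | hexOf-j , posOf-j rewrite hexOf-j | posOf-j | hexOf-c | posOf-c = chainDist-same off N _ (off N)

wiener≡wienerSum : ∀ {n off} → IsSpiroChain n off → 1 ≤ n → wiener n off ≡ wienerSum n off
wiener≡wienerSum {n} {off} spiro 1≤n =
  trans (sum-concatMap (λ u → map (λ v → if u <ᵇ v then dist n off u v else 0) (vertices n)) (vertices n))
        (sumMap-cong (vertices n) (λ {u} u∈ → sumMap-cong (vertices n) (λ {v} v∈ →
          cong (λ d → if u <ᵇ v then d else 0) (dist≡spiroDist u v spiro 1≤n (∈-upTo⁻ u∈) (∈-upTo⁻ v∈)))))

cut-vertex : ∀ {N off} → IsSpiroChain (suc N) off → IsVertex N (c off N)
cut-vertex {zero}  _     = s≤s z≤n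
cut-vertex {suc N} spiro = s≤s (≤-trans (+-monoʳ-≤ (5 * N) (proj₂ (spiro N ≤-refl))) (lastOfHex≤ ≤-refl))

cut-spacing : ∀ {n off} j → IsSpiroChain n off → suc j < n →
              spiroDist off (c off j) (c off (suc j)) ≡ hexDist 0 (off j)
cut-spacing {n} {off} j spiro j+1<n with spiro j j+1<n
... | 1≤off , off≤5 with home-loc j (off j) 1≤off off≤5
... | hexOf-c , posOf-c = begin
  spiroDist off (c off j) (c off (suc j))
    ≡⟨ via-cut (spiro-prefix (<⇒≤ j+1<n) spiro) (cut-vertex (spiro-prefix (<⇒≤ j+1<n) spiro)) hexOf-c ⟩
  spiroDist off (c off j) (c off j) + hexDist 0 (posOf (c off (suc j)))
    ≡⟨ cong₂ (λ d p → d + hexDist 0 p) (spiroDist-self off (c off j)) posOf-c ⟩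
  hexDist 0 (off j) ∎
  where open ≡-Reasoning

-- one step of the closed form 2·cutSum N = 18N + 5t·N(N-1)
cutSum-step : ∀ s s′ t t′ N → N * t′ ≡ N * t → s′ + t′ ≡ s + t′ * suc (5 * N) + 9 →
              2 * s + 5 * t * N ≡ 18 * N + 5 * t * (N * N) →
              2 * s′ + 5 * t * suc N ≡ 18 * suc N + 5 * t * (suc N * suc N)
cutSum-step s s′ t t′ N spacing rec closed = begin
  2 * s′ + 5 * t * suc N                         ≡⟨ cong (λ x → 2 * x + 5 * t * suc N) s′≡ ⟩
  2 * (s + 5 * (N * t) + 9) + 5 * t * suc N      ≡⟨ regroup s t N ⟩
  (2 * s + 5 * t * N) + (10 * (N * t) + 18 + 5 * t) ≡⟨ cong (_+ (10 * (N * t) + 18 + 5 * t)) closed ⟩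
  18 * N + 5 * t * (N * N) + (10 * (N * t) + 18 + 5 * t) ≡⟨ expand t N ⟩
  18 * suc N + 5 * t * (suc N * suc N)           ∎
  where
  open ≡-Reasoning
  spread : ∀ s t′ N → s + t′ * suc (5 * N) + 9 ≡ s + 5 * (N * t′) + 9 + t′
  spread = solve-∀
  s′≡ : s′ ≡ s + 5 * (N * t) + 9
  s′≡ = +-cancelʳ-≡ t′ _ _ (begin
    s′ + t′                          ≡⟨ rec ⟩
    s + t′ * suc (5 * N) + 9         ≡⟨ spread s t′ N ⟩
    s + 5 * (N * t′) + 9 + t′        ≡⟨ cong (λ x → s + 5 * x + 9 + t′) spacing ⟩
    s + 5 * (N * t) + 9 + t′         ∎)
  regroup : ∀ s t N → 2 * (s + 5 * (N * t) + 9) + 5 * t * suc N ≡ (2 * s + 5 * t * N) + (10 * (N * t) + 18 + 5 * t)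
  regroup = solve-∀
  expand : ∀ t N → 18 * N + 5 * t * (N * N) + (10 * (N * t) + 18 + 5 * t) ≡ 18 * suc N + 5 * t * (suc N * suc N)
  expand = solve-∀

-- one step of the closed form 6·wienerSum N = 25t·N(N-1)(N-2) + 270·N(N-1) + 162·N
wienerSum-step : ∀ w w′ s t N → w′ ≡ w + (5 * s + 9 * suc (5 * N)) + 18 →
                 2 * s + 5 * t * N ≡ 18 * N + 5 * t * (N * N) →
                 6 * w + 75 * t * (N * N) + 108 * N ≡ 25 * t * (N * N * N) + 50 * t * N + 270 * (N * N) →
                 6 * w′ + 75 * t * (suc N * suc N) + 108 * suc N
                   ≡ 25 * t * (suc N * suc N * suc N) + 50 * t * suc N + 270 * (suc N * suc N)
wienerSum-step w w′ s t N refl cut closed = +-cancelʳ-≡ (75 * t * N) _ _ (begin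
  6 * (w + (5 * s + 9 * suc (5 * N)) + 18) + 75 * t * (suc N * suc N) + 108 * suc N + 75 * t * N
    ≡⟨ regroup w s t N ⟩
  (6 * w + 75 * t * (N * N) + 108 * N) + 15 * (2 * s + 5 * t * N) + (270 * N + 270 + 150 * t * N + 75 * t)
    ≡⟨ cong₂ (λ x y → x + 15 * y + (270 * N + 270 + 150 * t * N + 75 * t)) closed cut ⟩
  (25 * t * (N * N * N) + 50 * t * N + 270 * (N * N)) + 15 * (18 * N + 5 * t * (N * N)) + (270 * N + 270 + 150 * t * N + 75 * t)
    ≡⟨ expand t N ⟩
  25 * t * (suc N * suc N * suc N) + 50 * t * suc N + 270 * (suc N * suc N) + 75 * t * N ∎)
  where
  open ≡-Reasoning
  regroup : ∀ w s t N →
    6 * (w + (5 * s + 9 * suc (5 * N)) + 18) + 75 * t * (suc N * suc N) + 108 * suc N + 75 * t * N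
      ≡ (6 * w + 75 * t * (N * N) + 108 * N) + 15 * (2 * s + 5 * t * N) + (270 * N + 270 + 150 * t * N + 75 * t)
  regroup = solve-∀
  expand : ∀ t N →
    (25 * t * (N * N * N) + 50 * t * N + 270 * (N * N)) + 15 * (18 * N + 5 * t * (N * N)) + (270 * N + 270 + 150 * t * N + 75 * t)
      ≡ 25 * t * (suc N * suc N * suc N) + 50 * t * suc N + 270 * (suc N * suc N) + 75 * t * N
  expand = solve-∀

module UniformSpacing {n : ℕ} {off : ℕ → ℕ} (t : ℕ) (spiro : IsSpiroChain n off)
  (spacing : ∀ j → 1 ≤ j → suc (suc j) ≤ n → hexDist 0 (off j) ≡ t) where

  cutSum-closed : ∀ N → suc N ≤ n → 2 * cutSum N off + 5 * t * N ≡ 18 * N + 5 * t * (N * N)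
  cutSum-closed zero    _       = zeroCase t
    where
    zeroCase : ∀ t → 2 * 0 + 5 * t * 0 ≡ 18 * 0 + 5 * t * (0 * 0)
    zeroCase = solve-∀
  cutSum-closed (suc N) N+2≤n = cutSum-step (cutSum N off) (cutSum (suc N) off) t (hexDist 0 (off N)) N
    (uniform N N+2≤n) (cutSum-suc (spiro-prefix N+2≤n spiro)) (cutSum-closed N (≤-trans (n≤1+n _) N+2≤n))
    where
    -- the spacing off c 0 is irrelevant since it is weighted by N = 0
    uniform : ∀ N → suc (suc N) ≤ n → N * hexDist 0 (off N) ≡ N * t
    uniform zero    _       = refl
    uniform (suc M) M+3≤n = cong (suc M *_) (spacing (suc M) (s≤s z≤n) M+3≤n)

  wienerSum-closed : ∀ N → N ≤ n →
                     6 * wienerSum N off + 75 * t * (N * N) + 108 * N ≡ 25 * t * (N * N * N) + 50 * t * N + 270 * (N * N)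
  wienerSum-closed zero    _     = zeroCase t
    where
    zeroCase : ∀ t → 6 * 0 + 75 * t * 0 + 108 * 0 ≡ 25 * t * 0 + 50 * t * 0 + 270 * 0
    zeroCase = solve-∀
  wienerSum-closed (suc N) N+1≤n = wienerSum-step (wienerSum N off) (wienerSum (suc N) off) (cutSum N off) t N
    (wienerSum-suc (spiro-prefix N+1≤n spiro)) (cutSum-closed N N+1≤n) (wienerSum-closed N (≤-trans (n≤1+n _) N+1≤n))

-- Wiener index of a spiro chain whose inner cut vertices are all at distance t:
-- 6·W = 25t·n(n-1)(n-2) + 270·n(n-1) + 162·n, written without subtraction.
wiener-uniform : ∀ t n off → 1 ≤ n → IsSpiroChain n off →
                 (∀ k → 2 ≤ k → suc k ≤ n → dist n off (c off (k ∸ 1)) (c off k) ≡ t) →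
                 6 * wiener n off + 75 * t * (n * n) + 108 * n ≡ 25 * t * (n * n * n) + 50 * t * n + 270 * (n * n)
wiener-uniform t n off 1≤n spiro cutDist = begin
  6 * wiener n off + 75 * t * (n * n) + 108 * n
    ≡⟨ cong (λ w → 6 * w + 75 * t * (n * n) + 108 * n) (wiener≡wienerSum spiro 1≤n) ⟩
  6 * wienerSum n off + 75 * t * (n * n) + 108 * n
    ≡⟨ UniformSpacing.wienerSum-closed t spiro spacing n ≤-refl ⟩
  25 * t * (n * n * n) + 50 * t * n + 270 * (n * n) ∎
  where
  open ≡-Reasoning
  spacing : ∀ j → 1 ≤ j → suc (suc j) ≤ n → hexDist 0 (off j) ≡ t
  spacing j 1≤j j+2≤n = begin
    hexDist 0 (off j)                        ≡⟨ cut-spacing j spiro j+2≤n ⟨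
    spiroDist off (c off j) (c off (suc j))  ≡⟨ dist≡spiroDist _ _ spiro 1≤n (loc-vertex j 0 spiro (<-trans (n<1+n j) j+2≤n) z≤n)
                                                                         (loc-vertex (suc j) 0 spiro j+2≤n z≤n) ⟨
    dist n off (c off j) (c off (suc j))     ≡⟨ cutDist (suc j) (s≤s 1≤j) j+2≤n ⟩
    t                                        ∎

rebalance : ∀ {x y a b} K → x + K ≡ a → b ≡ y + K → a ≡ b → x ≡ y
rebalance K x+K≡a b≡y+K a≡b = +-cancelʳ-≡ K _ _ (trans x+K≡a (trans a≡b b≡y+K))

-- spiro ortho-chains: consecutive inner cut vertices at distance 1
wiener-ortho : ∀ n (off : ℕ → ℕ) → 1 ≤ n → IsSpiroChain n off →
               (∀ k → 2 ≤ k → suc k ≤ n → dist n off (c off (k ∸ 1)) (c off k) ≡ 1) →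
               6 * wiener n off + 58 * n ≡ 25 * n ^ 3 + 195 * n ^ 2
wiener-ortho n off 1≤n spiro cutDist =
  rebalance (75 * (n * n) + 50 * n) (left (wiener n off) n) (right n) (wiener-uniform 1 n off 1≤n spiro cutDist)
  where
  left : ∀ w n → 6 * w + 58 * n + (75 * (n * n) + 50 * n) ≡ 6 * w + 75 * 1 * (n * n) + 108 * n
  left = solve-∀
  right : ∀ n → 25 * 1 * (n * n * n) + 50 * 1 * n + 270 * (n * n)
                ≡ 25 * (n * (n * (n * 1))) + 195 * (n * (n * 1)) + (75 * (n * n) + 50 * n)
  right = solve-∀

-- spiro meta-chains: consecutive inner cut vertices at distance 2
wiener-meta : ∀ n (off : ℕ → ℕ) → 1 ≤ n → IsSpiroChain n off →
              (∀ k → 2 ≤ k → suc k ≤ n → dist n off (c off (k ∸ 1)) (c off k) ≡ 2) →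
              6 * wiener n off + 8 * n ≡ 50 * n ^ 3 + 120 * n ^ 2
wiener-meta n off 1≤n spiro cutDist =
  rebalance (150 * (n * n) + 100 * n) (left (wiener n off) n) (right n) (wiener-uniform 2 n off 1≤n spiro cutDist)
  where
  left : ∀ w n → 6 * w + 8 * n + (150 * (n * n) + 100 * n) ≡ 6 * w + 75 * 2 * (n * n) + 108 * n
  left = solve-∀
  right : ∀ n → 25 * 2 * (n * n * n) + 50 * 2 * n + 270 * (n * n)
                ≡ 50 * (n * (n * (n * 1))) + 120 * (n * (n * 1)) + (150 * (n * n) + 100 * n)
  right = solve-∀

-- spiro para-chains: consecutive inner cut vertices at distance 3
wiener-para : ∀ n (off : ℕ → ℕ) → 1 ≤ n → IsSpiroChain n off →
              (∀ k → 2 ≤ k → suc k ≤ n → dist n off (c off (k ∸ 1)) (c off k) ≡ 3) →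
              6 * wiener n off ≡ 75 * n ^ 3 + 45 * n ^ 2 + 42 * n
wiener-para n off 1≤n spiro cutDist =
  rebalance (225 * (n * n) + 108 * n) (left (wiener n off) n) (right n) (wiener-uniform 3 n off 1≤n spiro cutDist)
  where
  left : ∀ w n → 6 * w + (225 * (n * n) + 108 * n) ≡ 6 * w + 75 * 3 * (n * n) + 108 * n
  left = solve-∀
  right : ∀ n → 25 * 3 * (n * n * n) + 50 * 3 * n + 270 * (n * n)
                ≡ 75 * (n * (n * (n * 1))) + 45 * (n * (n * 1)) + 42 * n + (225 * (n * n) + 108 * n)
  right = solve-∀

corollary2p3 : (∀ n (off : ℕ → ℕ) → 1 ≤ n → IsSpiroChain n off →
    (∀ k → 2 ≤ k → suc k ≤ n → dist n off (c off (k ∸ 1)) (c off k) ≡ 1) →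
    6 * wiener n off + 58 * n ≡ 25 * n ^ 3 + 195 * n ^ 2)
    × (∀ n (off : ℕ → ℕ) → 1 ≤ n → IsSpiroChain n off →
    (∀ k → 2 ≤ k → suc k ≤ n → dist n off (c off (k ∸ 1)) (c off k) ≡ 2) →
    6 * wiener n off + 8 * n ≡ 50 * n ^ 3 + 120 * n ^ 2)
    × (∀ n (off : ℕ → ℕ) → 1 ≤ n → IsSpiroChain n off →
    (∀ k → 2 ≤ k → suc k ≤ n → dist n off (c off (k ∸ 1)) (c off k) ≡ 3) →
    6 * wiener n off ≡ 75 * n ^ 3 + 45 * n ^ 2 + 42 * n)
corollary2p3 = wiener-ortho , wiener-meta , wiener-para
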